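{- The schema $\bigcirc(B\mid A)\land\Diamond A\rightarrow\Diamond B$ is not valid in the class of CJ-models: there exist a CJ-model $M=\langle W,\mathrm{av},\mathrm{pv},\mathrm{ob},V\rangle$, propositional atoms $A,B$ and a world $w\in W$ such that $w\models\bigcirc(B\mid A)$ and $w\models\Diamond A$ but $w\not\models\Diamond B$.
   Context: A CJ-model is a tuple $M=\langle W,\mathrm{av},\mathrm{pv},\mathrm{ob},V\rangle$ where $W\neq\emptyset$; $V$ is a valuation assigning to each propositional atom a subset of $W$, extended to all formulas in the usual way, and $\|A\|=\{x\in W: x\models A\}$ denotes the truth set of $A$; $\mathrm{av},\mathrm{pv}:W\to\mathcal P(W)$ with $w\in\mathrm{av}(w)\subseteq\mathrm{pv}(w)$ for all $w\in W$; and $\mathrm{ob}:\mathcal P(W)\to\mathcal P(\mathcal P(W))$ satisfies, for all $X,Y,Z\subseteq W$: (1) $\emptyset\notin\mathrm{ob}(X)$; (2) if $Y\cap X=Z\cap X$ then ($Y\in\mathrm{ob}(X)\iff Z\in\mathrm{ob}(X)$); (3) if $Y\in\mathrm{ob}(X)$ and $Z\in\mathrm{ob}(X)$ then $Y\cap Z\in\mathrm{ob}(X)$; (4) if $X\subseteq Y\subseteq Z$ and $X\in\mathrm{ob}(Y)$ then $(Z\setminus Y)\cup X\in\mathrm{ob}(Z)$. Truth conditions: $w\models\Box A$ iff $\mathrm{pv}(w)\subseteq\|A\|$; $\Diamond A$ abbreviates $\neg\Box\neg A$, so $w\models\Diamond A$ iff $\mathrm{pv}(w)\cap\|A\|\neq\emptyset$;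 $w\models\bigcirc(B\mid A)$ iff $\|B\|\cap\|A\|\neq\emptyset$ and for every $X\subseteq\|A\|$ with $X\cap\|B\|\neq\emptyset$ we have $\|B\|\in\mathrm{ob}(X)$. -}

module Defs where

open import Data.Nat using (ℕ)
open import Data.Product using (Σ; _×_; _,_)
open import Data.Sum using (_⊎_)
open import Data.Empty using (⊥)
open import Relation.Nullary using (¬_)
open import Function.Bundles using (_⇔_)

Subset : Set → Set₁
Subset W = W → Set

module _ {W : Set} where
  _⊆_ : Subset W → Subset W → Set
  X ⊆ Y = ∀ x → X x → Y x

  _≐_ : Subset W → Subset W → Set
  X ≐ Y = X ⊆ Y × Y ⊆ X

  ∅ : Subset W
  ∅ _ = ⊥

  _∩_ : Subset W → Subset W → Subset W
  (X ∩ Y) x = X x × Y x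

  _∪_ : Subset W → Subset W → Subset W
  (X ∪ Y) x = X x ⊎ Y x

  _∖_ : Subset W → Subset W → Subset W
  (X ∖ Y) x = X x × ¬ Y x

  Nonempty : Subset W → Set
  Nonempty X = Σ W X

record CJModel : Set₁ where
  field
    W   : Set
    av  : W → Subset W
    pv  : W → Subset W
    ob  : Subset W → Subset W → Set   -- ob X Y  means  Y ∈ ob(X)
    V   : ℕ → Subset W
    av-refl : ∀ w → av w w
    av⊆pv   : ∀ w → av w ⊆ pv w
    -- ob is a function on *sets*: it respects extensional equality
    ob-cong : ∀ {X X′ Y Y′} → X ≐ X′ → Y ≐ Y′ → ob X Y → ob X′ Y′
    ob-1 : ∀ X → ¬ ob X ∅
    ob-2 : ∀ X Y Z → (Y ∩ X) ≐ (Z ∩ X) → ob X Y ⇔ ob X Z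
    ob-3 : ∀ X Y Z → ob X Y → ob X Z → ob X (Y ∩ Z)
    ob-4 : ∀ X Y Z → X ⊆ Y → Y ⊆ Z → ob Y X → ob Z ((Z ∖ Y) ∪ X)

-- The dyadic operator ○(B | A) quantifies over all subsets of W, so its truth
-- value lives in Set₁; it is given separately (for ○-free arguments, which
-- covers the atoms used in the theorem).
data Form : Set where
  atom : ℕ → Form
  ¬′_  : Form → Form
  _∧′_ : Form → Form → Form
  □_   : Form → Form

◇_ : Form → Form
◇ A = ¬′ (□ (¬′ A))

module Semantics (M : CJModel) where
  open CJModel M

  _⊨_ : W → Form → Set
  ‖_‖ : Form → Subset W

  w ⊨ atom p = V p w
  w ⊨ (¬′ A) = ¬ (w ⊨ A)
  w ⊨ (A ∧′ B) = (w ⊨ A) × (w ⊨ B)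
  w ⊨ (□ A) = pv w ⊆ ‖ A ‖

  ‖ A ‖ x = x ⊨ A

  _⊨○⟨_∣_⟩ : W → Form → Form → Set₁
  w ⊨○⟨ B ∣ A ⟩ =
    Nonempty (‖ B ‖ ∩ ‖ A ‖) ×
    (∀ X → X ⊆ ‖ A ‖ → Nonempty (X ∩ ‖ B ‖) → ob X ‖ B ‖)

-- The conditional obligation ○(B | A) only constrains ob on subsets of ‖A‖,
-- while ◇ looks at the worlds pv(w) reachable from w, and nothing links the
-- two. Take a single ideal world t, let Y ∈ ob(X) mean t ∈ X ∩ Y, and let
-- every world see only itself. With ‖A‖ = W and ‖B‖ = {t}, ○(B | A) holds
-- everywhere, while at any world w ≠ t we have ◇A but not ◇B.
module Submission where

open import Defs
open import Data.Nat using (ℕ; zero; suc)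
open import Data.Product using (Σ; _×_; _,_; proj₁)
open import Data.Sum using (inj₂)
open import Data.Bool using (Bool; true; false)
open import Data.Unit using (⊤; tt)
open import Relation.Nullary using (¬_)
open import Relation.Binary.PropositionalEquality using (_≡_; refl; subst)
open import Function.Bundles using (mk⇔)

module _ (M : CJModel) where
  open CJModel M
  open Semantics M

  ◇-intro : ∀ {w} A → w ⊨ A → w ⊨ (◇ A)
  ◇-intro {w} A w⊨A w⊨□¬A = w⊨□¬A w (av⊆pv w w (av-refl w)) w⊨A

idealWorldModel : (W : Set) → W → (ℕ → Subset W) → CJModel
idealWorldModel W t V = record
  { W       = W
  ; av      = λ w x → x ≡ w
  ; pv      = λ w x → x ≡ w
  ; ob      = λ X Y → (X ∩ Y) t
  ; V       = V
  ; av-refl = λ _ → refl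
  ; av⊆pv   = λ _ _ x≡w → x≡w
  ; ob-cong = λ { (X⊆X′ , _) (Y⊆Y′ , _) (Xt , Yt) → X⊆X′ t Xt , Y⊆Y′ t Yt }
  ; ob-1    = λ { _ (_ , ()) }
  ; ob-2    = λ _ _ _ (Y∩X⊆Z∩X , Z∩X⊆Y∩X) → mk⇔
      (λ { (Xt , Yt) → Xt , proj₁ (Y∩X⊆Z∩X t (Yt , Xt)) })
      (λ { (Xt , Zt) → Xt , proj₁ (Z∩X⊆Y∩X t (Zt , Xt)) })
  ; ob-3    = λ _ _ _ (Xt , Yt) (_ , Zt) → Xt , Yt , Zt
  ; ob-4    = λ _ _ _ _ Y⊆Z (Yt , Xt) → Y⊆Z t Yt , inj₂ Xt
  }

module _ (W : Set) (t : W) (V : ℕ → Subset W) where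
  open Semantics (idealWorldModel W t V)

  ○-ideal : ∀ {w} A B → t ⊨ A → t ⊨ B → ‖ B ‖ ⊆ (_≡ t) → w ⊨○⟨ B ∣ A ⟩
  ○-ideal A B t⊨A t⊨B B⊆t =
    (t , t⊨B , t⊨A) ,
    λ { X _ (x , Xx , x⊨B) → subst X (B⊆t x x⊨B) Xx , t⊨B }

  ¬⇒¬◇ : ∀ {w} A → ¬ w ⊨ A → ¬ w ⊨ (◇ A)
  ¬⇒¬◇ A w⊭A w⊨◇A = w⊨◇A λ { _ refl → w⊭A }

valuation : ℕ → Subset Bool
valuation zero    _ = ⊤
valuation (suc _) x = x ≡ true

mainTheorem1 : Σ CJModel (λ M → Σ ℕ (λ A → Σ ℕ (λ B → Σ (CJModel.W M) (λ w →
    Semantics._⊨○⟨_∣_⟩ M w (atom B) (atom A)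
    × Semantics._⊨_ M w (◇ (atom A))
    × ¬ Semantics._⊨_ M w (◇ (atom B))))))
mainTheorem1 =
  M , 0 , 1 , false ,
  ○-ideal Bool true valuation {false} (atom 0) (atom 1) tt refl (λ _ x≡true → x≡true) ,
  ◇-intro M {false} (atom 0) tt ,
  ¬⇒¬◇ Bool true valuation (atom 1) λ ()
  where
  M : CJModel
  M = idealWorldModel Bool true valuation
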